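{- Let $z_1,\dots,z_n\in\mathbb{Q}[\mathbf{i}]$ and $S=\{z_1,\dots,z_n\}$ such that $|z_j|=|z_k|\neq 0$ for all $j,k\in\{1,\dots,n\}$. Write $n=2^s m$ with $s\in\mathbb{Z}_{\ge0}$ and $m$ odd. Then there exists $j\in\{0,1,\dots,s\}$ such that $M_{2^j}(S)=\sum_{\ell=1}^n z_\ell^{2^j}\neq 0$.
   Context: $\mathbb{Q}[\mathbf{i}]=\{x+y\mathbf{i}: x,y\in\mathbb{Q}\}$ with $\mathbf{i}=\sqrt{ -1}$. For a (multi)set $S\subseteq\mathbb{C}$ and an integer $k\ge 0$, the complex moment is $M_k(S)=\sum_{z\in S}z^k$ (summing with multiplicity). -}

module Defs where

open import Data.Nat using (ℕ; zero; suc)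
open import Data.Fin using (Fin)
open import Data.Rational using (ℚ; 0ℚ; 1ℚ)
  renaming (_+_ to _+ℚ_; _*_ to _*ℚ_; _-_ to _-ℚ_)

record ℚ[i] : Set where
  constructor _+_i
  field
    re : ℚ
    im : ℚ
open ℚ[i] public

0ℚi : ℚ[i]
0ℚi = 0ℚ + 0ℚ i

1ℚi : ℚ[i]
1ℚi = 1ℚ + 0ℚ i

_⊕_ : ℚ[i] → ℚ[i] → ℚ[i]
(a + b i) ⊕ (c + d i) = (a +ℚ c) + (b +ℚ d) i

_⊗_ : ℚ[i] → ℚ[i] → ℚ[i]
(a + b i) ⊗ (c + d i) = ((a *ℚ c) -ℚ (b *ℚ d)) + ((a *ℚ d) +ℚ (b *ℚ c)) i

_^ᵢ_ : ℚ[i] → ℕ → ℚ[i]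
z ^ᵢ zero  = 1ℚi
z ^ᵢ suc k = z ⊗ (z ^ᵢ k)

-- squared modulus |z|² = re² + im²  (|z| itself is irrational in general)
absSq : ℚ[i] → ℚ
absSq z = (re z *ℚ re z) +ℚ (im z *ℚ im z)

∑ : (n : ℕ) → (Fin n → ℚ[i]) → ℚ[i]
∑ zero    f = 0ℚi
∑ (suc n) f = f Fin.zero ⊕ ∑ n (λ i → f (Fin.suc i))
  where import Data.Fin as Fin

M : (k : ℕ) → {n : ℕ} → (Fin n → ℚ[i]) → ℚ[i]
M k {n} z = ∑ n (λ ℓ → z ℓ ^ᵢ k)

-- Clearing denominators turns the zℓ into Gaussian integers gℓ = d zℓ of a common norm N ≠ 0,
-- and multiplies each moment M_k by d^k. Since a² + b² ≡ a + b (mod 2), an even N makes every gℓ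
-- divisible by 1 + i, and dividing by 1 + i halves N while again only rescaling the moments; so we
-- may assume N odd, i.e. gℓ ≡ 1 or i (mod 2). Then Re gℓ + Im gℓ ≡ 1 (mod 2),
-- Re gℓ² ≡ 2 Re gℓ - 1 (mod 4), and gℓ^(2^j) ≡ 1 (mod 2^(j+1)) for j ≥ 2, because squaring turns a
-- congruence modulo 2k into one modulo 4k. Summed over ℓ, these show that the vanishing of M_1,
-- of M_1 and M_2, resp. of M_(2^s), forces 2^(s+1) ∣ n, which n = 2^s m with m odd excludes.
-- Equality in ℚ[i] being decidable, a nonvanishing M_(2^j) with j ≤ s is then found by search.

module Submission where

open import Defs

module GaussianRationals where

  open import Data.Fin using (Fin; zero; suc)
  open import Data.Nat as ℕ using (ℕ)
  open import Data.Product using (_,_; uncurry)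
  open import Data.Rational using (0ℚ; 1ℚ; ½; _+_; _*_; _-_; -_; 1/_; NonZero; ≢-nonZero)
  open import Data.Rational.Properties as ℚP
    using (+-*-commutativeRing; *-identityˡ; *-inverseˡ; *-assoc; *-zeroʳ)
  open import Level using (0ℓ)
  open import Relation.Binary.Definitions using (DecidableEquality)
  open import Relation.Binary.PropositionalEquality
  open import Relation.Nullary.Decidable using (dec⇒maybe; map′; _×-dec_)
  open import Tactic.RingSolver using (solve-∀)
  open import Tactic.RingSolver.Core.AlmostCommutativeRing
    using (AlmostCommutativeRing; fromCommutativeRing)
  open ≡-Reasoning

  ℚ-ring : AlmostCommutativeRing 0ℓ 0ℓ
  ℚ-ring = fromCommutativeRing +-*-commutativeRing (λ x → dec⇒maybe (0ℚ ℚP.≟ x))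

  *-≢0 : ∀ {p q} → p ≢ 0ℚ → q ≢ 0ℚ → p * q ≢ 0ℚ
  *-≢0 {p} {q} p≢0 q≢0 pq≡0 = q≢0 (begin
    q                  ≡⟨ sym (*-identityˡ q) ⟩
    1ℚ * q             ≡⟨ cong (_* q) (sym (*-inverseˡ p)) ⟩
    ((1/ p) * p) * q   ≡⟨ *-assoc (1/ p) p q ⟩
    (1/ p) * (p * q)   ≡⟨ cong ((1/ p) *_) pq≡0 ⟩
    (1/ p) * 0ℚ        ≡⟨ *-zeroʳ (1/ p) ⟩
    0ℚ                 ∎)
    where
    instance
      p-nonZero : NonZero p
      p-nonZero = ≢-nonZero p≢0

  _≟ᵢ_ : DecidableEquality ℚ[i]
  (a + b i) ≟ᵢ (c + d i) =
    map′ (uncurry (cong₂ _+_i)) (λ e → cong re e , cong im e) ((a ℚP.≟ c) ×-dec (b ℚP.≟ d))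

  ⊗-zeroʳ : ∀ x → x ⊗ 0ℚi ≡ 0ℚi
  ⊗-zeroʳ (a + b i) = cong₂ _+_i (re-eq a b) (im-eq a b)
    where
    re-eq : ∀ a b → a * 0ℚ - b * 0ℚ ≡ 0ℚ
    re-eq = solve-∀ ℚ-ring
    im-eq : ∀ a b → a * 0ℚ + b * 0ℚ ≡ 0ℚ
    im-eq = solve-∀ ℚ-ring

  ⊗-distribˡ-⊕ : ∀ x y z → x ⊗ (y ⊕ z) ≡ (x ⊗ y) ⊕ (x ⊗ z)
  ⊗-distribˡ-⊕ (a + b i) (c + d i) (e + f i) = cong₂ _+_i (re-eq a b c d e f) (im-eq a b c d e f)
    where
    re-eq : ∀ a b c d e f → a * (c + e) - b * (d + f) ≡ (a * c - b * d) + (a * e - b * f)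
    re-eq = solve-∀ ℚ-ring
    im-eq : ∀ a b c d e f → a * (d + f) + b * (c + e) ≡ (a * d + b * c) + (a * f + b * e)
    im-eq = solve-∀ ℚ-ring

  ⊗-interchange : ∀ w x y z → (w ⊗ x) ⊗ (y ⊗ z) ≡ (w ⊗ y) ⊗ (x ⊗ z)
  ⊗-interchange (a + b i) (c + d i) (e + f i) (g + h i) =
    cong₂ _+_i (re-eq a b c d e f g h) (im-eq a b c d e f g h)
    where
    re-eq : ∀ a b c d e f g h →
            (a * c - b * d) * (e * g - f * h) - (a * d + b * c) * (e * h + f * g)
            ≡ (a * e - b * f) * (c * g - d * h) - (a * f + b * e) * (c * h + d * g)
    re-eq = solve-∀ ℚ-ring
    im-eq : ∀ a b c d e f g h →
            (a * c - b * d) * (e * h + f * g) + (a * d + b * c) * (e * g - f * h)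
            ≡ (a * e - b * f) * (c * h + d * g) + (a * f + b * e) * (c * g - d * h)
    im-eq = solve-∀ ℚ-ring

  absSq-⊗ : ∀ x y → absSq (x ⊗ y) ≡ absSq x * absSq y
  absSq-⊗ (a + b i) (c + d i) = eq a b c d
    where
    eq : ∀ a b c d → (a * c - b * d) * (a * c - b * d) + (a * d + b * c) * (a * d + b * c)
                     ≡ (a * a + b * b) * (c * c + d * d)
    eq = solve-∀ ℚ-ring

  ⊗-scalarˡ : ∀ c x → (c + 0ℚ i) ⊗ x ≡ (c * re x) + (c * im x) i
  ⊗-scalarˡ c (a + b i) = cong₂ _+_i (re-eq c a b) (im-eq c a b)
    where
    re-eq : ∀ c a b → c * a - 0ℚ * b ≡ c * a
    re-eq = solve-∀ ℚ-ring
    im-eq : ∀ c a b → c * b + 0ℚ * a ≡ c * b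
    im-eq = solve-∀ ℚ-ring

  absSq-scalar : ∀ c → absSq (c + 0ℚ i) ≡ c * c
  absSq-scalar c = eq c
    where
    eq : ∀ c → c * c + 0ℚ * 0ℚ ≡ c * c
    eq = solve-∀ ℚ-ring

  ½[1-i] : ℚ[i]
  ½[1-i] = ½ + (- ½) i

  ½[1-i]⊗[1+i]⊗ : ∀ x → ½[1-i] ⊗ ((1ℚ + 1ℚ i) ⊗ x) ≡ x
  ½[1-i]⊗[1+i]⊗ (a + b i) = cong₂ _+_i (re-eq a b) (im-eq a b)
    where
    re-eq : ∀ a b → ½ * (1ℚ * a - 1ℚ * b) - (- ½) * (1ℚ * b + 1ℚ * a) ≡ a
    re-eq = solve-∀ ℚ-ring
    im-eq : ∀ a b → ½ * (1ℚ * b + 1ℚ * a) + (- ½) * (1ℚ * a - 1ℚ * b) ≡ b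
    im-eq = solve-∀ ℚ-ring

  ^ᵢ-distrib-⊗ : ∀ x y k → (x ⊗ y) ^ᵢ k ≡ (x ^ᵢ k) ⊗ (y ^ᵢ k)
  ^ᵢ-distrib-⊗ x y ℕ.zero    = refl
  ^ᵢ-distrib-⊗ x y (ℕ.suc k) = begin
    (x ⊗ y) ⊗ ((x ⊗ y) ^ᵢ k)       ≡⟨ cong ((x ⊗ y) ⊗_) (^ᵢ-distrib-⊗ x y k) ⟩
    (x ⊗ y) ⊗ ((x ^ᵢ k) ⊗ (y ^ᵢ k))  ≡⟨ ⊗-interchange x y (x ^ᵢ k) (y ^ᵢ k) ⟩
    (x ⊗ (x ^ᵢ k)) ⊗ (y ⊗ (y ^ᵢ k))  ∎

  ∑-cong : ∀ n {f g : Fin n → ℚ[i]} → (∀ ℓ → f ℓ ≡ g ℓ) → ∑ n f ≡ ∑ n g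
  ∑-cong ℕ.zero    f≗g = refl
  ∑-cong (ℕ.suc n) f≗g = cong₂ _⊕_ (f≗g zero) (∑-cong n (λ ℓ → f≗g (suc ℓ)))

  ⊗-distribˡ-∑ : ∀ n c (f : Fin n → ℚ[i]) → c ⊗ (∑ n f) ≡ ∑ n (λ ℓ → c ⊗ f ℓ)
  ⊗-distribˡ-∑ ℕ.zero    c f = ⊗-zeroʳ c
  ⊗-distribˡ-∑ (ℕ.suc n) c f = begin
    c ⊗ (f zero ⊕ (∑ n f′))            ≡⟨ ⊗-distribˡ-⊕ c (f zero) (∑ n f′) ⟩
    (c ⊗ f zero) ⊕ (c ⊗ (∑ n f′))      ≡⟨ cong ((c ⊗ f zero) ⊕_) (⊗-distribˡ-∑ n c f′) ⟩
    (c ⊗ f zero) ⊕ (∑ n (λ ℓ → c ⊗ f′ ℓ))  ∎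
    where
    f′ : Fin n → ℚ[i]
    f′ ℓ = f (suc ℓ)

  M-scale : ∀ k {n} c (z : Fin n → ℚ[i]) → M k (λ ℓ → c ⊗ z ℓ) ≡ (c ^ᵢ k) ⊗ (M k z)
  M-scale k {n} c z = begin
    ∑ n (λ ℓ → (c ⊗ z ℓ) ^ᵢ k)        ≡⟨ ∑-cong n (λ ℓ → ^ᵢ-distrib-⊗ c (z ℓ) k) ⟩
    ∑ n (λ ℓ → (c ^ᵢ k) ⊗ (z ℓ ^ᵢ k)) ≡⟨ sym (⊗-distribˡ-∑ n (c ^ᵢ k) (λ ℓ → z ℓ ^ᵢ k)) ⟩
    (c ^ᵢ k) ⊗ (M k z)                ∎

  DyadicMomentsVanish : ℕ → {n : ℕ} → (Fin n → ℚ[i]) → Set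
  DyadicMomentsVanish s z = ∀ j → j ℕ.≤ s → M (2 ℕ.^ j) z ≡ 0ℚi

  DyadicMomentsVanish-scale : ∀ {s n} c (z : Fin n → ℚ[i]) {w} → (∀ ℓ → w ℓ ≡ c ⊗ z ℓ) →
                              DyadicMomentsVanish s z → DyadicMomentsVanish s w
  DyadicMomentsVanish-scale {n = n} c z {w} w≡cz vanish j j≤s = begin
    M k w                     ≡⟨ ∑-cong n (λ ℓ → cong (_^ᵢ k) (w≡cz ℓ)) ⟩
    M k (λ ℓ → c ⊗ z ℓ)       ≡⟨ M-scale k c z ⟩
    (c ^ᵢ k) ⊗ (M k z)        ≡⟨ cong ((c ^ᵢ k) ⊗_) (vanish j j≤s) ⟩
    (c ^ᵢ k) ⊗ 0ℚi            ≡⟨ ⊗-zeroʳ (c ^ᵢ k) ⟩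
    0ℚi                       ∎
    where
    k : ℕ
    k = 2 ℕ.^ j

module RationalsFromIntegers where

  open import Algebra.Bundles using (CommutativeRing)
  import Algebra.Properties.CommutativeSemigroup as CommutativeSemigroupProperties
  open import Data.Fin using (Fin; zero; suc)
  open import Data.Integer using (ℤ; +_; -[1+_]; 0ℤ; 1ℤ; _+_; _-_; _*_; -_)
  open import Data.Integer.Properties using (i*j≡0⇒i≡0∨j≡0)
  open import Data.Integer.Tactic.RingSolver using (solve-∀)
  import Data.Nat as ℕ
  import Data.Nat.Properties as ℕP
  open import Data.Product using (∃-syntax; Σ-syntax; _×_; _,_)
  open import Data.Rational as ℚ using (ℚ; mkℚ; ↥_; ↧_)
  open import Data.Rational.Literals using (fromℤ)
  open import Data.Rational.Properties as ℚP
    using (+-*-commutativeRing; toℚᵘ-injective; toℚᵘ-homo-+; toℚᵘ-homo-*)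
  open import Data.Rational.Unnormalised using (*≡*)
  open import Data.Rational.Unnormalised.Properties using (≃-trans; ≃-sym)
  open import Data.Sum using ([_,_]′)
  open import Relation.Binary.PropositionalEquality
  open CommutativeSemigroupProperties (CommutativeRing.*-commutativeSemigroup +-*-commutativeRing)
    using (xy∙z≈xz∙y)
  open ≡-Reasoning

  fromℤ-injective : ∀ {a b} → fromℤ a ≡ fromℤ b → a ≡ b
  fromℤ-injective = cong ↥_

  fromℤ-+ : ∀ a b → fromℤ (a + b) ≡ fromℤ a ℚ.+ fromℤ b
  fromℤ-+ a b = toℚᵘ-injective (≃-trans (*≡* (eq a b)) (≃-sym (toℚᵘ-homo-+ (fromℤ a) (fromℤ b))))
    where
    eq : ∀ a b → (a + b) * + 1 ≡ (a * + 1 + b * + 1) * + 1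
    eq = solve-∀

  fromℤ-* : ∀ a b → fromℤ (a * b) ≡ fromℤ a ℚ.* fromℤ b
  fromℤ-* a b = toℚᵘ-injective (≃-trans (*≡* refl) (≃-sym (toℚᵘ-homo-* (fromℤ a) (fromℤ b))))

  fromℤ-neg : ∀ a → fromℤ (- a) ≡ ℚ.- fromℤ a
  fromℤ-neg (+ ℕ.zero)  = refl
  fromℤ-neg (+ ℕ.suc _) = refl
  fromℤ-neg -[1+ _ ]    = refl

  fromℤ-- : ∀ a b → fromℤ (a - b) ≡ fromℤ a ℚ.- fromℤ b
  fromℤ-- a b = trans (fromℤ-+ a (- b)) (cong (fromℤ a ℚ.+_) (fromℤ-neg b))

  fromℤ-↥ : ∀ q → fromℤ (↥ q) ≡ fromℤ (↧ q) ℚ.* q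
  fromℤ-↥ q@(mkℚ a d-1 _) =
    toℚᵘ-injective (≃-trans (*≡* eq) (≃-sym (toℚᵘ-homo-* (fromℤ (↧ q)) q)))
    where
    swap : ∀ a d → a * d ≡ (d * a) * + 1
    swap = solve-∀
    eq : a * + ℕ.suc (d-1 ℕ.+ 0) ≡ (+ ℕ.suc d-1 * a) * + 1
    eq rewrite ℕP.+-identityʳ d-1 = swap a (+ ℕ.suc d-1)

  commonDenominator : ∀ n (q : Fin n → ℚ) →
                      ∃[ d ] (d ≢ 0ℤ × Σ[ x ∈ (Fin n → ℤ) ] ∀ ℓ → fromℤ (x ℓ) ≡ fromℤ d ℚ.* q ℓ)
  commonDenominator ℕ.zero    q = 1ℤ , (λ ()) , (λ ()) , (λ ())
  commonDenominator (ℕ.suc n) q with commonDenominator n (λ ℓ → q (suc ℓ))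
  ... | d , d≢0 , x , x≡dq = ↧ q₀ * d , d′≢0 , x′ , x′≡d′q
    where
    q₀ : ℚ
    q₀ = q zero
    d′≢0 : ↧ q₀ * d ≢ 0ℤ
    d′≢0 e = [ (λ ()) , d≢0 ]′ (i*j≡0⇒i≡0∨j≡0 (↧ q₀) e)
    x′ : Fin (ℕ.suc n) → ℤ
    x′ zero    = ↥ q₀ * d
    x′ (suc ℓ) = ↧ q₀ * x ℓ
    x′≡d′q : ∀ ℓ → fromℤ (x′ ℓ) ≡ fromℤ (↧ q₀ * d) ℚ.* q ℓ
    x′≡d′q zero = begin
      fromℤ (↥ q₀ * d)                          ≡⟨ fromℤ-* (↥ q₀) d ⟩
      fromℤ (↥ q₀) ℚ.* fromℤ d                  ≡⟨ cong (ℚ._* fromℤ d) (fromℤ-↥ q₀) ⟩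
      (fromℤ (↧ q₀) ℚ.* q₀) ℚ.* fromℤ d         ≡⟨ xy∙z≈xz∙y (fromℤ (↧ q₀)) q₀ (fromℤ d) ⟩
      (fromℤ (↧ q₀) ℚ.* fromℤ d) ℚ.* q₀         ≡⟨ cong (ℚ._* q₀) (fromℤ-* (↧ q₀) d) ⟨
      fromℤ (↧ q₀ * d) ℚ.* q₀                   ∎
    x′≡d′q (suc ℓ) = begin
      fromℤ (↧ q₀ * x ℓ)                        ≡⟨ fromℤ-* (↧ q₀) (x ℓ) ⟩
      fromℤ (↧ q₀) ℚ.* fromℤ (x ℓ)              ≡⟨ cong (fromℤ (↧ q₀) ℚ.*_) (x≡dq ℓ) ⟩
      fromℤ (↧ q₀) ℚ.* (fromℤ d ℚ.* q (suc ℓ))  ≡⟨ ℚP.*-assoc (fromℤ (↧ q₀)) (fromℤ d) (q (suc ℓ)) ⟨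
      (fromℤ (↧ q₀) ℚ.* fromℤ d) ℚ.* q (suc ℓ)  ≡⟨ cong (ℚ._* q (suc ℓ)) (fromℤ-* (↧ q₀) d) ⟨
      fromℤ (↧ q₀ * d) ℚ.* q (suc ℓ)            ∎

module GaussianIntegers where

  open import Algebra.Bundles using (CommutativeRing)
  import Algebra.Properties.CommutativeSemigroup as CommutativeSemigroupProperties
  open import Data.Fin using (Fin; zero; suc)
  open import Data.Integer using (ℤ; 0ℤ; 1ℤ; _+_; _-_; _*_; +-0-rawMonoid)
  open import Algebra.Definitions.RawMonoid +-0-rawMonoid using (sum)
  open import Data.Integer.Properties using (i*j≡0⇒i≡0∨j≡0)
  open import Data.Integer.Tactic.RingSolver using (solve-∀)
  open import Data.Nat as ℕ using (ℕ)
  import Data.Nat.Properties as ℕP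
  open import Data.Product using (∃-syntax; Σ-syntax; _×_; _,_; proj₁; proj₂)
  open import Data.Rational as ℚ using (0ℚ)
  open import Data.Rational.Literals using (fromℤ)
  open import Data.Rational.Properties as ℚP using (+-*-commutativeRing)
  open import Data.Sum using ([_,_]′)
  open import Relation.Binary.PropositionalEquality
  open CommutativeSemigroupProperties (CommutativeRing.*-commutativeSemigroup +-*-commutativeRing)
    using (xy∙z≈xz∙y)
  open ≡-Reasoning
  open GaussianRationals using (∑-cong; ⊗-scalarˡ)
  open RationalsFromIntegers

  ℤ[i] : Set
  ℤ[i] = ℤ × ℤ

  0ᶻ 1ᶻ iᶻ 1+iᶻ : ℤ[i]
  0ᶻ   = 0ℤ , 0ℤ
  1ᶻ   = 1ℤ , 0ℤ
  iᶻ   = 0ℤ , 1ℤ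
  1+iᶻ = 1ℤ , 1ℤ

  infixl 7 _⊗ᶻ_
  infixr 8 _^ᶻ_

  _⊗ᶻ_ : ℤ[i] → ℤ[i] → ℤ[i]
  (a , b) ⊗ᶻ (c , d) = a * c - b * d , a * d + b * c

  _^ᶻ_ : ℤ[i] → ℕ → ℤ[i]
  x ^ᶻ ℕ.zero  = 1ᶻ
  x ^ᶻ ℕ.suc k = x ⊗ᶻ x ^ᶻ k

  absSqᶻ : ℤ[i] → ℤ
  absSqᶻ (a , b) = a * a + b * b

  Mᶻ : ℕ → {n : ℕ} → (Fin n → ℤ[i]) → ℤ[i]
  Mᶻ k g = sum (λ ℓ → proj₁ (g ℓ ^ᶻ k)) , sum (λ ℓ → proj₂ (g ℓ ^ᶻ k))

  ⊗ᶻ-assoc : ∀ x y z → (x ⊗ᶻ y) ⊗ᶻ z ≡ x ⊗ᶻ (y ⊗ᶻ z)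
  ⊗ᶻ-assoc (a , b) (c , d) (e , f) = cong₂ _,_ (re-eq a b c d e f) (im-eq a b c d e f)
    where
    re-eq : ∀ a b c d e f → (a * c - b * d) * e - (a * d + b * c) * f
                            ≡ a * (c * e - d * f) - b * (c * f + d * e)
    re-eq = solve-∀
    im-eq : ∀ a b c d e f → (a * c - b * d) * f + (a * d + b * c) * e
                            ≡ a * (c * f + d * e) + b * (c * e - d * f)
    im-eq = solve-∀

  ⊗ᶻ-identityˡ : ∀ x → 1ᶻ ⊗ᶻ x ≡ x
  ⊗ᶻ-identityˡ (a , b) = cong₂ _,_ (re-eq a b) (im-eq a b)
    where
    re-eq : ∀ a b → 1ℤ * a - 0ℤ * b ≡ a
    re-eq = solve-∀
    im-eq : ∀ a b → 1ℤ * b + 0ℤ * a ≡ b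
    im-eq = solve-∀

  ⊗ᶻ-identityʳ : ∀ x → x ⊗ᶻ 1ᶻ ≡ x
  ⊗ᶻ-identityʳ (a , b) = cong₂ _,_ (re-eq a b) (im-eq a b)
    where
    re-eq : ∀ a b → a * 1ℤ - b * 0ℤ ≡ a
    re-eq = solve-∀
    im-eq : ∀ a b → a * 0ℤ + b * 1ℤ ≡ b
    im-eq = solve-∀

  absSqᶻ-⊗ᶻ : ∀ x y → absSqᶻ (x ⊗ᶻ y) ≡ absSqᶻ x * absSqᶻ y
  absSqᶻ-⊗ᶻ (a , b) (c , d) = eq a b c d
    where
    eq : ∀ a b c d → (a * c - b * d) * (a * c - b * d) + (a * d + b * c) * (a * d + b * c)
                     ≡ (a * a + b * b) * (c * c + d * d)
    eq = solve-∀

  ^ᶻ-identityʳ : ∀ x → x ^ᶻ 1 ≡ x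
  ^ᶻ-identityʳ = ⊗ᶻ-identityʳ

  ^ᶻ-distribˡ-+ : ∀ x m n → x ^ᶻ (m ℕ.+ n) ≡ x ^ᶻ m ⊗ᶻ x ^ᶻ n
  ^ᶻ-distribˡ-+ x ℕ.zero    n = sym (⊗ᶻ-identityˡ (x ^ᶻ n))
  ^ᶻ-distribˡ-+ x (ℕ.suc m) n = begin
    x ⊗ᶻ x ^ᶻ (m ℕ.+ n)        ≡⟨ cong (x ⊗ᶻ_) (^ᶻ-distribˡ-+ x m n) ⟩
    x ⊗ᶻ (x ^ᶻ m ⊗ᶻ x ^ᶻ n)    ≡⟨ ⊗ᶻ-assoc x (x ^ᶻ m) (x ^ᶻ n) ⟨
    x ⊗ᶻ x ^ᶻ m ⊗ᶻ x ^ᶻ n      ∎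

  ^ᶻ-2^-suc : ∀ x j → x ^ᶻ 2 ℕ.^ ℕ.suc j ≡ x ^ᶻ 2 ℕ.^ j ⊗ᶻ x ^ᶻ 2 ℕ.^ j
  ^ᶻ-2^-suc x j = begin
    x ^ᶻ (2 ℕ.^ j ℕ.+ (2 ℕ.^ j ℕ.+ 0))   ≡⟨ cong (λ k → x ^ᶻ (2 ℕ.^ j ℕ.+ k)) (ℕP.+-identityʳ (2 ℕ.^ j)) ⟩
    x ^ᶻ (2 ℕ.^ j ℕ.+ 2 ℕ.^ j)           ≡⟨ ^ᶻ-distribˡ-+ x (2 ℕ.^ j) (2 ℕ.^ j) ⟩
    x ^ᶻ 2 ℕ.^ j ⊗ᶻ x ^ᶻ 2 ℕ.^ j         ∎

  ^ᶻ-2 : ∀ x → x ^ᶻ 2 ≡ x ⊗ᶻ x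
  ^ᶻ-2 x = trans (^ᶻ-2^-suc x 0) (cong₂ _⊗ᶻ_ (^ᶻ-identityʳ x) (^ᶻ-identityʳ x))

  toℚ[i] : ℤ[i] → ℚ[i]
  toℚ[i] (a , b) = fromℤ a + fromℤ b i

  toℚ[i]-injective : ∀ {x y} → toℚ[i] x ≡ toℚ[i] y → x ≡ y
  toℚ[i]-injective e = cong₂ _,_ (fromℤ-injective (cong re e)) (fromℤ-injective (cong im e))

  toℚ[i]-⊗ᶻ : ∀ x y → toℚ[i] (x ⊗ᶻ y) ≡ toℚ[i] x ⊗ toℚ[i] y
  toℚ[i]-⊗ᶻ (a , b) (c , d) = cong₂ _+_i
    (trans (fromℤ-- (a * c) (b * d)) (cong₂ ℚ._-_ (fromℤ-* a c) (fromℤ-* b d)))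
    (trans (fromℤ-+ (a * d) (b * c)) (cong₂ ℚ._+_ (fromℤ-* a d) (fromℤ-* b c)))

  toℚ[i]-^ᶻ : ∀ x k → toℚ[i] (x ^ᶻ k) ≡ toℚ[i] x ^ᵢ k
  toℚ[i]-^ᶻ x ℕ.zero    = refl
  toℚ[i]-^ᶻ x (ℕ.suc k) = trans (toℚ[i]-⊗ᶻ x (x ^ᶻ k)) (cong (toℚ[i] x ⊗_) (toℚ[i]-^ᶻ x k))

  fromℤ-absSqᶻ : ∀ x → fromℤ (absSqᶻ x) ≡ absSq (toℚ[i] x)
  fromℤ-absSqᶻ (a , b) = trans (fromℤ-+ (a * a) (b * b)) (cong₂ ℚ._+_ (fromℤ-* a a) (fromℤ-* b b))

  toℚ[i]-sum : ∀ n (f : Fin n → ℤ[i]) →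
               toℚ[i] (sum (λ ℓ → proj₁ (f ℓ)) , sum (λ ℓ → proj₂ (f ℓ))) ≡ ∑ n (λ ℓ → toℚ[i] (f ℓ))
  toℚ[i]-sum ℕ.zero    f = refl
  toℚ[i]-sum (ℕ.suc n) f =
    trans (cong₂ _+_i (fromℤ-+ (proj₁ (f zero)) (sum (λ ℓ → proj₁ (f (suc ℓ)))))
                      (fromℤ-+ (proj₂ (f zero)) (sum (λ ℓ → proj₂ (f (suc ℓ))))))
          (cong (toℚ[i] (f zero) ⊕_) (toℚ[i]-sum n (λ ℓ → f (suc ℓ))))

  toℚ[i]-Mᶻ : ∀ k {n} (g : Fin n → ℤ[i]) → toℚ[i] (Mᶻ k g) ≡ M k (λ ℓ → toℚ[i] (g ℓ))
  toℚ[i]-Mᶻ k {n} g = trans (toℚ[i]-sum n (λ ℓ → g ℓ ^ᶻ k)) (∑-cong n (λ ℓ → toℚ[i]-^ᶻ (g ℓ) k))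

  Mᶻ≡0 : ∀ k {n} (g : Fin n → ℤ[i]) → M k (λ ℓ → toℚ[i] (g ℓ)) ≡ 0ℚi → Mᶻ k g ≡ 0ᶻ
  Mᶻ≡0 k g M≡0 = toℚ[i]-injective (trans (toℚ[i]-Mᶻ k g) M≡0)

  gaussianCommonDenominator : ∀ n (z : Fin n → ℚ[i]) →
    ∃[ d ] (d ≢ 0ℤ × Σ[ g ∈ (Fin n → ℤ[i]) ] ∀ ℓ → toℚ[i] (g ℓ) ≡ (fromℤ d + 0ℚ i) ⊗ z ℓ)
  gaussianCommonDenominator n z
    with commonDenominator n (λ ℓ → re (z ℓ)) | commonDenominator n (λ ℓ → im (z ℓ))
  ... | d₁ , d₁≢0 , x , x≡d₁re | d₂ , d₂≢0 , y , y≡d₂im =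
    d₁ * d₂ , d≢0 , (λ ℓ → x ℓ * d₂ , d₁ * y ℓ) ,
    λ ℓ → trans (cong₂ _+_i (re-part ℓ) (im-part ℓ)) (sym (⊗-scalarˡ (fromℤ (d₁ * d₂)) (z ℓ)))
    where
    d≢0 : d₁ * d₂ ≢ 0ℤ
    d≢0 e = [ d₁≢0 , d₂≢0 ]′ (i*j≡0⇒i≡0∨j≡0 d₁ e)
    re-part : ∀ ℓ → fromℤ (x ℓ * d₂) ≡ fromℤ (d₁ * d₂) ℚ.* re (z ℓ)
    re-part ℓ = begin
      fromℤ (x ℓ * d₂)                          ≡⟨ fromℤ-* (x ℓ) d₂ ⟩
      fromℤ (x ℓ) ℚ.* fromℤ d₂                  ≡⟨ cong (ℚ._* fromℤ d₂) (x≡d₁re ℓ) ⟩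
      (fromℤ d₁ ℚ.* re (z ℓ)) ℚ.* fromℤ d₂      ≡⟨ xy∙z≈xz∙y (fromℤ d₁) (re (z ℓ)) (fromℤ d₂) ⟩
      (fromℤ d₁ ℚ.* fromℤ d₂) ℚ.* re (z ℓ)      ≡⟨ cong (ℚ._* re (z ℓ)) (fromℤ-* d₁ d₂) ⟨
      fromℤ (d₁ * d₂) ℚ.* re (z ℓ)              ∎
    im-part : ∀ ℓ → fromℤ (d₁ * y ℓ) ≡ fromℤ (d₁ * d₂) ℚ.* im (z ℓ)
    im-part ℓ = begin
      fromℤ (d₁ * y ℓ)                          ≡⟨ fromℤ-* d₁ (y ℓ) ⟩
      fromℤ d₁ ℚ.* fromℤ (y ℓ)                  ≡⟨ cong (fromℤ d₁ ℚ.*_) (y≡d₂im ℓ) ⟩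
      fromℤ d₁ ℚ.* (fromℤ d₂ ℚ.* im (z ℓ))      ≡⟨ ℚP.*-assoc (fromℤ d₁) (fromℤ d₂) (im (z ℓ)) ⟨
      (fromℤ d₁ ℚ.* fromℤ d₂) ℚ.* im (z ℓ)      ≡⟨ cong (ℚ._* im (z ℓ)) (fromℤ-* d₁ d₂) ⟨
      fromℤ (d₁ * d₂) ℚ.* im (z ℓ)              ∎


module Congruences where

  open import Data.Fin using (Fin; zero; suc)
  open import Data.Integer using (ℤ; +_; 0ℤ; 1ℤ; _+_; _-_; -_; _*_; _^_; ∣_∣; _%ℕ_; _/ℕ_; +-0-rawMonoid)
  open import Algebra.Definitions.RawMonoid +-0-rawMonoid using (sum)
  open import Data.Integer.DivMod using (a≡a%ℕn+[a/ℕn]*n; n%ℕd<d)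
  open import Data.Integer.Properties using (+-identityˡ; *-identityʳ; abs-*)
  open import Data.Integer.Tactic.RingSolver using (solve-∀)
  open import Data.Nat as ℕ using (s≤s)
  import Data.Nat.Properties as ℕP
  open import Data.Nat.Divisibility using (_∣_; divides)
  open import Data.Product using (_×_; _,_; proj₁; proj₂)
  open import Data.Sum using (_⊎_; inj₁; inj₂)
  open import Relation.Binary.PropositionalEquality
  open ≡-Reasoning
  open GaussianIntegers using (ℤ[i]; absSqᶻ)

  infix 4 _≡_mod_ _≡ᶻ_mod_
  infix 5 _by_

  record _≡_mod_ (x y k : ℤ) : Set where
    constructor _by_
    field
      quotient : ℤ
      equation : x ≡ y + k * quotient

  _≡ᶻ_mod_ : ℤ[i] → ℤ[i] → ℤ → Set
  x ≡ᶻ y mod k = proj₁ x ≡ proj₁ y mod k × proj₂ x ≡ proj₂ y mod k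

  ≡mod-trans : ∀ {x y z k} → x ≡ y mod k → y ≡ z mod k → x ≡ z mod k
  ≡mod-trans {z = z} {k} (q by refl) (q′ by refl) = q′ + q by eq z k q q′
    where
    eq : ∀ z k q q′ → (z + k * q′) + k * q ≡ z + k * (q′ + q)
    eq = solve-∀

  +-≡mod : ∀ {x x′ y y′ k} → x ≡ x′ mod k → y ≡ y′ mod k → x + y ≡ x′ + y′ mod k
  +-≡mod {x′ = x′} {y′ = y′} {k} (q by refl) (q′ by refl) = q + q′ by eq x′ y′ k q q′
    where
    eq : ∀ x′ y′ k q q′ → (x′ + k * q) + (y′ + k * q′) ≡ (x′ + y′) + k * (q + q′)
    eq = solve-∀

  x+y≡z⇒y≡z-x : ∀ {x y z} → x + y ≡ z → y ≡ z - x
  x+y≡z⇒y≡z-x {x} {y} refl = eq x y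
    where
    eq : ∀ x y → y ≡ (x + y) - x
    eq = solve-∀

  parity : ∀ x → x ≡ 0ℤ mod + 2 ⊎ x ≡ 1ℤ mod + 2
  parity x with x %ℕ 2 | a≡a%ℕn+[a/ℕn]*n x 2 | n%ℕd<d x 2
  ... | 0 | e | _ = inj₁ (x /ℕ 2 by trans e (eq₀ (x /ℕ 2)))
    where
    eq₀ : ∀ q → + 0 + q * + 2 ≡ 0ℤ + + 2 * q
    eq₀ = solve-∀
  ... | 1 | e | _ = inj₂ (x /ℕ 2 by trans e (eq₁ (x /ℕ 2)))
    where
    eq₁ : ∀ q → + 1 + q * + 2 ≡ 1ℤ + + 2 * q
    eq₁ = solve-∀
  ... | ℕ.suc (ℕ.suc _) | _ | s≤s (s≤s ())

  ≡*self-mod2 : ∀ x → x ≡ x * x mod + 2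
  ≡*self-mod2 x with parity x
  ... | inj₁ (q by refl) = q - + 2 * q * q by eq₀ q
    where
    eq₀ : ∀ q → 0ℤ + + 2 * q ≡ (0ℤ + + 2 * q) * (0ℤ + + 2 * q) + + 2 * (q - + 2 * q * q)
    eq₀ = solve-∀
  ... | inj₂ (q by refl) = - q - + 2 * q * q by eq₁ q
    where
    eq₁ : ∀ q → 1ℤ + + 2 * q ≡ (1ℤ + + 2 * q) * (1ℤ + + 2 * q) + + 2 * (- q - + 2 * q * q)
    eq₁ = solve-∀

  re+im≡absSqᶻ-mod2 : ∀ x → proj₁ x + proj₂ x ≡ absSqᶻ x mod + 2
  re+im≡absSqᶻ-mod2 (a , b) = +-≡mod (≡*self-mod2 a) (≡*self-mod2 b)

  sum-≡mod-affine : ∀ {n} {f x : Fin n → ℤ} {c u k} → (∀ ℓ → f ℓ ≡ c + u * x ℓ mod k) →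
                    sum f ≡ + n * c + u * sum x mod k
  sum-≡mod-affine {ℕ.zero} {c = c} {u} {k} _ = 0ℤ by eq c u k
    where
    eq : ∀ c u k → 0ℤ ≡ + 0 * c + u * 0ℤ + k * 0ℤ
    eq = solve-∀
  sum-≡mod-affine {ℕ.suc n} {f} {x} {c} {u} {k} f≡
    with f≡ zero | sum-≡mod-affine {n} {λ ℓ → f (suc ℓ)} {λ ℓ → x (suc ℓ)} {c} {u} {k} (λ ℓ → f≡ (suc ℓ))
  ... | q by e | q′ by e′ = q + q′ by (begin
    f zero + sum (λ ℓ → f (suc ℓ))                        ≡⟨ cong₂ _+_ e e′ ⟩
    (c + u * x zero + k * q) + (+ n * c + u * X + k * q′) ≡⟨ eq (+ n) c u k (x zero) X q q′ ⟩
    + ℕ.suc n * c + u * sum x + k * (q + q′)             ∎)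
    where
    X : ℤ
    X = sum (λ ℓ → x (suc ℓ))
    eq : ∀ n c u k x₀ X q q′ → (c + u * x₀ + k * q) + (n * c + u * X + k * q′)
                               ≡ (1ℤ + n) * c + u * (x₀ + X) + k * (q + q′)
    eq = solve-∀

  affine-sums-vanish⇒n≡0 : ∀ {n k} c u (f x : Fin n → ℤ) → c * c ≡ 1ℤ →
                          (∀ ℓ → f ℓ ≡ c + u * x ℓ mod k) → sum f ≡ 0ℤ → sum x ≡ 0ℤ →
                          + n ≡ 0ℤ mod k
  affine-sums-vanish⇒n≡0 {n} {k} c u f x c²≡1 f≡ ∑f≡0 ∑x≡0 with sum-≡mod-affine {n} {f} {x} {c} {u} {k} f≡
  ... | q by e = - (q * c) by (begin
    + n                                            ≡⟨ sym (trans (cong (+ n *_) c²≡1) (*-identityʳ (+ n))) ⟩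
    + n * (c * c)                                  ≡⟨ eq₁ (+ n) c u k q ⟩
    ((+ n * c + u * 0ℤ) + k * q) * c - k * q * c   ≡⟨ cong (λ t → t * c - k * q * c) e′ ⟨
    0ℤ * c - k * q * c                             ≡⟨ eq₂ c k q ⟩
    0ℤ + k * - (q * c)                             ∎)
    where
    e′ : 0ℤ ≡ (+ n * c + u * 0ℤ) + k * q
    e′ = subst₂ (λ s t → s ≡ + n * c + u * t + k * q) ∑f≡0 ∑x≡0 e
    eq₁ : ∀ n c u k q → n * (c * c) ≡ ((n * c + u * 0ℤ) + k * q) * c - k * q * c
    eq₁ = solve-∀
    eq₂ : ∀ c k q → 0ℤ * c - k * q * c ≡ 0ℤ + k * - (q * c)
    eq₂ = solve-∀

  abs-^ : ∀ x k → ∣ x ^ k ∣ ≡ ∣ x ∣ ℕ.^ k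
  abs-^ x ℕ.zero    = refl
  abs-^ x (ℕ.suc k) = trans (abs-* x (x ^ k)) (cong (∣ x ∣ ℕ.*_) (abs-^ x k))

  ≡0-mod⇒∣ : ∀ {n k} → + n ≡ 0ℤ mod k → ∣ k ∣ ∣ n
  ≡0-mod⇒∣ {n} {k} (q by e) =
    divides ∣ q ∣ (trans (cong ∣_∣ (trans e (+-identityˡ (k * q))))
                         (trans (abs-* k q) (ℕP.*-comm ∣ k ∣ ∣ q ∣)))

module DyadicMoments where

  open import Data.Fin using (Fin; zero)
  open import Data.Integer using (+_; 0ℤ; 1ℤ; -1ℤ; _+_; _-_; _*_; _^_; ∣_∣)
  open import Data.Integer.Properties using (+-comm; +-identityˡ; *-cancelˡ-≡; abs-*; ∣i∣≡0⇒i≡0)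
  open import Data.Integer.Tactic.RingSolver using (solve-∀)
  open import Data.Nat as ℕ using (z≤n; s≤s)
  import Data.Nat.Properties as ℕP
  open import Data.Nat.Divisibility using (_∣_; _∣0)
  open import Data.Nat.Induction using (<-wellFounded)
  open import Data.Product using (∃-syntax; Σ-syntax; _×_; _,_; proj₁; proj₂)
  open import Data.Rational as ℚ using (0ℚ; 1ℚ)
  open import Data.Rational.Literals using (fromℤ)
  open import Data.Sum using (_⊎_; inj₁; inj₂)
  open import Function using (_∘_)
  open import Induction.WellFounded using (Acc; acc)
  open import Relation.Binary.PropositionalEquality
  open ≡-Reasoning
  open GaussianRationals
  open RationalsFromIntegers
  open GaussianIntegers
  open Congruences

  re≡1-im : ∀ {a b k} → a + b ≡ 1ℤ mod k → a ≡ 1ℤ + -1ℤ * b mod k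
  re≡1-im {a} {b} {k} (q by e) = q by (begin
    a                      ≡⟨ x+y≡z⇒y≡z-x (trans (+-comm b a) e) ⟩
    (1ℤ + k * q) - b       ≡⟨ eq b k q ⟩
    1ℤ + -1ℤ * b + k * q   ∎)
    where
    eq : ∀ b k q → (1ℤ + k * q) - b ≡ 1ℤ + -1ℤ * b + k * q
    eq = solve-∀

  ≡ᶻ1⇒re+im≡1 : ∀ {x k} → x ≡ᶻ 1ᶻ mod k → proj₁ x + proj₂ x ≡ 1ℤ mod k
  ≡ᶻ1⇒re+im≡1 (re≡1 , im≡0) = +-≡mod re≡1 im≡0

  ≡1∨≡i-mod2 : ∀ {x} → proj₁ x + proj₂ x ≡ 1ℤ mod + 2 → x ≡ᶻ 1ᶻ mod + 2 ⊎ x ≡ᶻ iᶻ mod + 2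
  ≡1∨≡i-mod2 {a , b} (p by e) with parity a
  ... | inj₁ (q by refl) = inj₂ ((q by refl) , (p - q by trans (x+y≡z⇒y≡z-x e) (eq₀ p q)))
    where
    eq₀ : ∀ p q → (1ℤ + + 2 * p) - (0ℤ + + 2 * q) ≡ 1ℤ + + 2 * (p - q)
    eq₀ = solve-∀
  ... | inj₂ (q by refl) = inj₁ ((q by refl) , (p - q by trans (x+y≡z⇒y≡z-x e) (eq₁ p q)))
    where
    eq₁ : ∀ p q → (1ℤ + + 2 * p) - (1ℤ + + 2 * q) ≡ 0ℤ + + 2 * (p - q)
    eq₁ = solve-∀

  re-square≡2re-1 : ∀ x → proj₁ x + proj₂ x ≡ 1ℤ mod + 2 → proj₁ (x ⊗ᶻ x) ≡ -1ℤ + + 2 * proj₁ x mod + 4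
  re-square≡2re-1 (a , b) (p by e) = a * p - p - p * p by (begin
    a * a - b * b                                        ≡⟨ cong (λ b → a * a - b * b) (x+y≡z⇒y≡z-x e) ⟩
    a * a - (1ℤ + + 2 * p - a) * (1ℤ + + 2 * p - a)      ≡⟨ eq a p ⟩
    -1ℤ + + 2 * a + + 4 * (a * p - p - p * p)            ∎)
    where
    eq : ∀ a p → a * a - (1ℤ + + 2 * p - a) * (1ℤ + + 2 * p - a) ≡ -1ℤ + + 2 * a + + 4 * (a * p - p - p * p)
    eq = solve-∀

  square-≡ᶻ : ∀ k x y → x ≡ᶻ y mod + 2 * k → x ⊗ᶻ x ≡ᶻ y ⊗ᶻ y mod + 2 * (+ 2 * k)
  square-≡ᶻ k (_ , _) (c , d) ((p by refl) , (q by refl)) =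
    (c * p - d * q + k * p * p - k * q * q by re-eq c d k p q) ,
    (c * q + d * p + + 2 * k * p * q by im-eq c d k p q)
    where
    re-eq : ∀ c d k p q →
            (c + + 2 * k * p) * (c + + 2 * k * p) - (d + + 2 * k * q) * (d + + 2 * k * q)
            ≡ (c * c - d * d) + + 2 * (+ 2 * k) * (c * p - d * q + k * p * p - k * q * q)
    re-eq = solve-∀
    im-eq : ∀ c d k p q →
            (c + + 2 * k * p) * (d + + 2 * k * q) + (d + + 2 * k * q) * (c + + 2 * k * p)
            ≡ (c * d + d * c) + + 2 * (+ 2 * k) * (c * q + d * p + + 2 * k * p * q)
    im-eq = solve-∀

  ^ᶻ-2^[2+t]≡1 : ∀ {x} → proj₁ x + proj₂ x ≡ 1ℤ mod + 2 →
                 ∀ t → x ^ᶻ 2 ℕ.^ (2 ℕ.+ t) ≡ᶻ 1ᶻ mod (+ 2) ^ (3 ℕ.+ t)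
  ^ᶻ-2^[2+t]≡1 {x} odd ℕ.zero = subst (λ w → w ≡ᶻ 1ᶻ mod + 8) (sym x⁴≡) x⁴≡1
    where
    x⁴≡ : x ^ᶻ 4 ≡ (x ⊗ᶻ x) ⊗ᶻ (x ⊗ᶻ x)
    x⁴≡ = trans (^ᶻ-2^-suc x 1) (cong₂ _⊗ᶻ_ (^ᶻ-2 x) (^ᶻ-2 x))
    x⁴≡1 : (x ⊗ᶻ x) ⊗ᶻ (x ⊗ᶻ x) ≡ᶻ 1ᶻ mod + 8
    x⁴≡1 with ≡1∨≡i-mod2 odd
    ... | inj₁ x≡1 = square-≡ᶻ (+ 2) (x ⊗ᶻ x) (1ᶻ ⊗ᶻ 1ᶻ) (square-≡ᶻ 1ℤ x 1ᶻ x≡1)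
    ... | inj₂ x≡i = square-≡ᶻ (+ 2) (x ⊗ᶻ x) (iᶻ ⊗ᶻ iᶻ) (square-≡ᶻ 1ℤ x iᶻ x≡i)
  ^ᶻ-2^[2+t]≡1 {x} odd (ℕ.suc t) =
    subst (λ w → w ≡ᶻ 1ᶻ mod (+ 2) ^ (4 ℕ.+ t)) (sym (^ᶻ-2^-suc x (2 ℕ.+ t)))
          (square-≡ᶻ ((+ 2) ^ (2 ℕ.+ t)) (x ^ᶻ 2 ℕ.^ (2 ℕ.+ t)) 1ᶻ (^ᶻ-2^[2+t]≡1 odd t))

  oddNorms⇒n≡0-mod-2^[1+s] : ∀ s {n} (g : Fin n → ℤ[i]) → (∀ ℓ → proj₁ (g ℓ) + proj₂ (g ℓ) ≡ 1ℤ mod + 2) →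
                       (∀ j → j ℕ.≤ s → Mᶻ (2 ℕ.^ j) g ≡ 0ᶻ) → + n ≡ 0ℤ mod (+ 2) ^ ℕ.suc s
  oddNorms⇒n≡0-mod-2^[1+s] ℕ.zero g odd vanish =
    affine-sums-vanish⇒n≡0 1ℤ -1ℤ (λ ℓ → proj₁ (g ℓ ^ᶻ 1)) (λ ℓ → proj₂ (g ℓ ^ᶻ 1)) refl step
                          (cong proj₁ M₁≡0) (cong proj₂ M₁≡0)
    where
    M₁≡0 : Mᶻ 1 g ≡ 0ᶻ
    M₁≡0 = vanish 0 z≤n
    step : ∀ ℓ → proj₁ (g ℓ ^ᶻ 1) ≡ 1ℤ + -1ℤ * proj₂ (g ℓ ^ᶻ 1) mod + 2
    step ℓ = subst (λ w → proj₁ w ≡ 1ℤ + -1ℤ * proj₂ w mod + 2) (sym (^ᶻ-identityʳ (g ℓ))) (re≡1-im (odd ℓ))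
  oddNorms⇒n≡0-mod-2^[1+s] (ℕ.suc ℕ.zero) g odd vanish =
    affine-sums-vanish⇒n≡0 -1ℤ (+ 2) (λ ℓ → proj₁ (g ℓ ^ᶻ 2)) (λ ℓ → proj₁ (g ℓ ^ᶻ 1)) refl step
                          (cong proj₁ (vanish 1 ℕP.≤-refl)) (cong proj₁ (vanish 0 z≤n))
    where
    step : ∀ ℓ → proj₁ (g ℓ ^ᶻ 2) ≡ -1ℤ + + 2 * proj₁ (g ℓ ^ᶻ 1) mod + 4
    step ℓ = subst₂ (λ w v → proj₁ w ≡ -1ℤ + + 2 * proj₁ v mod + 4)
                    (sym (^ᶻ-2 (g ℓ))) (sym (^ᶻ-identityʳ (g ℓ))) (re-square≡2re-1 (g ℓ) (odd ℓ))
  oddNorms⇒n≡0-mod-2^[1+s] (ℕ.suc (ℕ.suc t)) {n} g odd vanish =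
    affine-sums-vanish⇒n≡0 1ℤ -1ℤ (λ ℓ → proj₁ (w ℓ)) (λ ℓ → proj₂ (w ℓ)) refl
                          (λ ℓ → re≡1-im (≡ᶻ1⇒re+im≡1 (^ᶻ-2^[2+t]≡1 (odd ℓ) t)))
                          (cong proj₁ M≡0) (cong proj₂ M≡0)
    where
    w : Fin n → ℤ[i]
    w ℓ = g ℓ ^ᶻ 2 ℕ.^ (2 ℕ.+ t)
    M≡0 : Mᶻ (2 ℕ.^ (2 ℕ.+ t)) g ≡ 0ᶻ
    M≡0 = vanish (2 ℕ.+ t) ℕP.≤-refl

  1+iᶻ∣ : ∀ x → proj₁ x + proj₂ x ≡ 0ℤ mod + 2 → ∃[ h ] x ≡ 1+iᶻ ⊗ᶻ h
  1+iᶻ∣ (a , b) (p by e) = (p , p - a) , cong₂ _,_ (re-eq a p) (trans (x+y≡z⇒y≡z-x e) (im-eq a p))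
    where
    re-eq : ∀ a p → a ≡ 1ℤ * p - 1ℤ * (p - a)
    re-eq = solve-∀
    im-eq : ∀ a p → (0ℤ + + 2 * p) - a ≡ 1ℤ * (p - a) + 1ℤ * p
    im-eq = solve-∀

  divideBy1+iᶻ : ∀ {n} (g : Fin n → ℤ[i]) N → (∀ ℓ → absSqᶻ (g ℓ) ≡ + 2 * N) →
            Σ[ h ∈ (Fin n → ℤ[i]) ] (∀ ℓ → absSqᶻ (h ℓ) ≡ N) × (∀ ℓ → toℚ[i] (h ℓ) ≡ ½[1-i] ⊗ toℚ[i] (g ℓ))
  divideBy1+iᶻ {n} g N norms = h , h-norms , h≡
    where
    divisible : ∀ ℓ → ∃[ h ] g ℓ ≡ 1+iᶻ ⊗ᶻ h
    divisible ℓ = 1+iᶻ∣ (g ℓ) (≡mod-trans (re+im≡absSqᶻ-mod2 (g ℓ)) even)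
      where
      even : absSqᶻ (g ℓ) ≡ 0ℤ mod + 2
      even = N by trans (norms ℓ) (sym (+-identityˡ (+ 2 * N)))
    h : Fin n → ℤ[i]
    h ℓ = proj₁ (divisible ℓ)
    h-norms : ∀ ℓ → absSqᶻ (h ℓ) ≡ N
    h-norms ℓ = *-cancelˡ-≡ (+ 2) (absSqᶻ (h ℓ)) N (begin
      + 2 * absSqᶻ (h ℓ)     ≡⟨ absSqᶻ-⊗ᶻ 1+iᶻ (h ℓ) ⟨
      absSqᶻ (1+iᶻ ⊗ᶻ h ℓ)   ≡⟨ cong absSqᶻ (proj₂ (divisible ℓ)) ⟨
      absSqᶻ (g ℓ)           ≡⟨ norms ℓ ⟩
      + 2 * N                ∎)
    h≡ : ∀ ℓ → toℚ[i] (h ℓ) ≡ ½[1-i] ⊗ toℚ[i] (g ℓ)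
    h≡ ℓ = begin
      toℚ[i] (h ℓ)                                  ≡⟨ ½[1-i]⊗[1+i]⊗ (toℚ[i] (h ℓ)) ⟨
      ½[1-i] ⊗ ((1ℚ + 1ℚ i) ⊗ toℚ[i] (h ℓ))         ≡⟨ cong (½[1-i] ⊗_) (toℚ[i]-⊗ᶻ 1+iᶻ (h ℓ)) ⟨
      ½[1-i] ⊗ toℚ[i] (1+iᶻ ⊗ᶻ h ℓ)                 ≡⟨ cong (λ w → ½[1-i] ⊗ toℚ[i] w) (proj₂ (divisible ℓ)) ⟨
      ½[1-i] ⊗ toℚ[i] (g ℓ)                         ∎

  ∣x∣<∣2x∣ : ∀ {x} → x ≢ 0ℤ → ∣ x ∣ ℕ.< ∣ + 2 * x ∣
  ∣x∣<∣2x∣ {x} x≢0 = subst (∣ x ∣ ℕ.<_) (trans (ℕP.*-comm ∣ x ∣ 2) (sym (abs-* (+ 2) x)))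
                            (ℕP.m<m*n ∣ x ∣ 2 {{ℕ.≢-nonZero (x≢0 ∘ ∣i∣≡0⇒i≡0)}} (s≤s (s≤s z≤n)))

  equalNorms⇒n≡0-mod-2^[1+s] : ∀ s {n} (g : Fin n → ℤ[i]) {N} → Acc ℕ._<_ ∣ N ∣ → N ≢ 0ℤ →
                               (∀ ℓ → absSqᶻ (g ℓ) ≡ N) →
                    DyadicMomentsVanish s (λ ℓ → toℚ[i] (g ℓ)) → + n ≡ 0ℤ mod (+ 2) ^ ℕ.suc s
  equalNorms⇒n≡0-mod-2^[1+s] s g {N} (acc smaller) N≢0 norms vanish with parity N
  ... | inj₂ N-odd = oddNorms⇒n≡0-mod-2^[1+s] s g odd (λ j j≤s → Mᶻ≡0 (2 ℕ.^ j) g (vanish j j≤s))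
    where
    odd : ∀ ℓ → proj₁ (g ℓ) + proj₂ (g ℓ) ≡ 1ℤ mod + 2
    odd ℓ = ≡mod-trans (re+im≡absSqᶻ-mod2 (g ℓ)) (subst (_≡ 1ℤ mod + 2) (sym (norms ℓ)) N-odd)
  ... | inj₁ (N′ by N≡0+2N′) =
    let h , h-norms , h≡ = divideBy1+iᶻ g N′ (λ ℓ → trans (norms ℓ) N≡2N′)
    in  equalNorms⇒n≡0-mod-2^[1+s] s h (smaller ∣N′∣<∣N∣) N′≢0 h-norms
                                   (DyadicMomentsVanish-scale ½[1-i] (λ ℓ → toℚ[i] (g ℓ)) h≡ vanish)
    where
    N≡2N′ : N ≡ + 2 * N′
    N≡2N′ = trans N≡0+2N′ (+-identityˡ (+ 2 * N′))
    N′≢0 : N′ ≢ 0ℤ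
    N′≢0 refl = N≢0 N≡2N′
    ∣N′∣<∣N∣ : ∣ N′ ∣ ℕ.< ∣ N ∣
    ∣N′∣<∣N∣ = subst (λ M → ∣ N′ ∣ ℕ.< ∣ M ∣) (sym N≡2N′) (∣x∣<∣2x∣ N′≢0)

  2^[1+s]∣n-cleared : ∀ s {n} (z : Fin (ℕ.suc n) → ℚ[i]) {d} → d ≢ 0ℤ → (g : Fin (ℕ.suc n) → ℤ[i]) →
                      (∀ ℓ → toℚ[i] (g ℓ) ≡ (fromℤ d + 0ℚ i) ⊗ z ℓ) →
                      (∀ j k → absSq (z j) ≡ absSq (z k)) → (∀ j → absSq (z j) ≢ 0ℚ) →
                      DyadicMomentsVanish s z → 2 ℕ.^ ℕ.suc s ∣ ℕ.suc n
  2^[1+s]∣n-cleared s {n} z {d} d≢0 g g≡cz equal nonzero vanish =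
    subst (_∣ ℕ.suc n) (abs-^ (+ 2) (ℕ.suc s))
          (≡0-mod⇒∣ (equalNorms⇒n≡0-mod-2^[1+s] s g (<-wellFounded _) N≢0 norms
                                                 (DyadicMomentsVanish-scale c z g≡cz vanish)))
    where
    c : ℚ[i]
    c = fromℤ d + 0ℚ i
    absSq-g : ∀ ℓ → fromℤ (absSqᶻ (g ℓ)) ≡ absSq c ℚ.* absSq (z ℓ)
    absSq-g ℓ = trans (fromℤ-absSqᶻ (g ℓ)) (trans (cong absSq (g≡cz ℓ)) (absSq-⊗ c (z ℓ)))
    norms : ∀ ℓ → absSqᶻ (g ℓ) ≡ absSqᶻ (g zero)
    norms ℓ = fromℤ-injective (begin
      fromℤ (absSqᶻ (g ℓ))              ≡⟨ absSq-g ℓ ⟩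
      absSq c ℚ.* absSq (z ℓ)           ≡⟨ cong (absSq c ℚ.*_) (equal ℓ zero) ⟩
      absSq c ℚ.* absSq (z zero)        ≡⟨ absSq-g zero ⟨
      fromℤ (absSqᶻ (g zero))           ∎)
    fromℤ-d≢0 : fromℤ d ≢ 0ℚ
    fromℤ-d≢0 = d≢0 ∘ fromℤ-injective {d} {0ℤ}
    absSq-c≢0 : absSq c ≢ 0ℚ
    absSq-c≢0 = subst (_≢ 0ℚ) (sym (absSq-scalar (fromℤ d))) (*-≢0 fromℤ-d≢0 fromℤ-d≢0)
    N≢0 : absSqᶻ (g zero) ≢ 0ℤ
    N≢0 N≡0 = *-≢0 absSq-c≢0 (nonzero zero) (trans (sym (absSq-g zero)) (cong fromℤ N≡0))

  2^[1+s]∣n : ∀ s {n} (z : Fin n → ℚ[i]) → (∀ j k → absSq (z j) ≡ absSq (z k)) → (∀ j → absSq (z j) ≢ 0ℚ) →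
              DyadicMomentsVanish s z → 2 ℕ.^ ℕ.suc s ∣ n
  2^[1+s]∣n s {ℕ.zero}  z _ _ _ = (2 ℕ.^ ℕ.suc s) ∣0
  2^[1+s]∣n s {ℕ.suc n} z =
    let d , d≢0 , g , g≡cz = gaussianCommonDenominator (ℕ.suc n) z
    in  2^[1+s]∣n-cleared s z d≢0 g g≡cz

open import Data.Nat using (ℕ; _*_; _^_; _≤_)
open import Data.Nat.Divisibility using (_∣_)
open import Data.Fin using (Fin)
open import Data.Rational using (0ℚ)
open import Data.Product using (∃-syntax; _×_)
open import Relation.Binary.PropositionalEquality using (_≡_; _≢_)
open import Relation.Nullary using (¬_)

open import Data.Fin using (toℕ; fromℕ<)
open import Data.Fin.Properties using (¬∀⟶∃¬; toℕ≤pred[n]; toℕ-fromℕ<)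
open import Data.Nat using (suc; s≤s; NonZero)
open import Data.Nat.Divisibility using (*-cancelˡ-∣)
open import Data.Nat.Properties using (*-comm; m^n≢0)
open import Data.Product using (_,_)
open import Function using (_∘_)
open import Relation.Binary.PropositionalEquality using (subst)
open GaussianRationals using (DyadicMomentsVanish; _≟ᵢ_)
open DyadicMoments using (2^[1+s]∣n)

p^[1+s]∣p^s*m⇒p∣m : ∀ p s m .{{_ : NonZero p}} → p ^ suc s ∣ p ^ s * m → p ∣ m
p^[1+s]∣p^s*m⇒p∣m p s m = *-cancelˡ-∣ (p ^ s) {{m^n≢0 p s}} ∘ subst (_∣ p ^ s * m) (*-comm p (p ^ s))

theorem1p5 : (n : ℕ) (z : Fin n → ℚ[i]) →
             (∀ j k → absSq (z j) ≡ absSq (z k)) →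
             (∀ j → absSq (z j) ≢ 0ℚ) →
             (s m : ℕ) → n ≡ 2 ^ s * m → ¬ (2 ∣ m) →
             ∃[ j ] (j ≤ s × M (2 ^ j) z ≢ 0ℚi)
theorem1p5 n z equal nonzero s m n≡2^s*m m-odd =
  let j , M≢0 = ¬∀⟶∃¬ (suc s) _ (λ j → M (2 ^ toℕ j) z ≟ᵢ 0ℚi) (m-odd ∘ 2∣m ∘ dyadic)
  in  toℕ j , toℕ≤pred[n] j , M≢0
  where
  dyadic : (∀ (j : Fin (suc s)) → M (2 ^ toℕ j) z ≡ 0ℚi) → DyadicMomentsVanish s z
  dyadic vanish j j≤s = subst (λ k → M (2 ^ k) z ≡ 0ℚi) (toℕ-fromℕ< (s≤s j≤s)) (vanish (fromℕ< (s≤s j≤s)))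
  2∣m : DyadicMomentsVanish s z → 2 ∣ m
  2∣m vanish = p^[1+s]∣p^s*m⇒p∣m 2 s m (subst (2 ^ suc s ∣_) n≡2^s*m (2^[1+s]∣n s z equal nonzero vanish))
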